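{- Let $G'$ be an $S$-graph with a spanning $S$-forest $F'$ satisfying the condition: if a $1$-vertex $u$ of $F'$ is incident to an edge of $\Delta(G',F')$, then the $2$-vertex $w$ of $F'$ with $(u,w)\in U(F')$ is not incident to any edge of $B(G',F')$. Then there exists a pair $(S,S')\in M_2(G')$ such that $(S\cup S')\cap\Delta(G',F')=\emptyset$.
   Context: Graphs are finite, simple. A matching is a set of pairwise non-adjacent edges. $B_2(G)$ is the set of ordered pairs of disjoint matchings; $\lambda(G)=\max\{|H|+|H'|:(H,H')\in B_2(G)\}$; $\alpha(G)=\max\{\max(|H|,|H'|):(H,H')\in B_2(G),|H|+|H'|=\lambda(G)\}$; $M_2(G)=\{(H,H')\in B_2(G):|H|+|H'|=\lambda(G),|H|=\alpha(G)\}$. The spanner is the tree on 10 vertices obtained from two paths $a_1b_1c_1d_1e_1$ and $a_2b_2c_2d_2e_2$ by adding the edge $c_1c_2$; its vertices of degree $i$ are $i$-vertices; the base of a vertex is the nearest $3$-vertex. $U(S)$: edges of spanner $S$ incident to a $1$-vertex; $L(S)$: edges not in $U(S)$ incident to a $2$-vertex. An $S$-forest is a forest whose components are spanners (with $i$-vertices, bases, $U(F)$, $L(F)$ inherited as unions); an $S$-graph is a graph containing an $S$-forest $F$ as a spanning subgraph. $\Delta(G,F)$ is the set of edges of $G$ joining a $1$-vertex of $F$ to its base; $B(G,F)=E(G)\setminus(L(F)\cup U(F)\cup\Delta(G,F))$. -}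

module Defs where

open import Data.Nat using (ℕ; _+_; _≤_; _⊔_; _<ᵇ_)
open import Data.Bool using (Bool; true; false; if_then_else_; _∧_)
open import Data.Fin using (Fin; toℕ)
open import Data.List using (List; _∷_; []; map; allFin)
open import Data.Nat.ListAction using (sum)
open import Data.Product using (Σ; _×_; _,_; proj₁; proj₂)
open import Data.Sum using (_⊎_)
open import Data.Empty using (⊥)
open import Relation.Nullary using (¬_)
open import Relation.Binary.PropositionalEquality using (_≡_)
open import Function.Bundles using (_↔_; Inverse)

record Graph (n : ℕ) : Set where
  field
    adj    : Fin n → Fin n → Bool
    sym    : ∀ i j → adj i j ≡ adj j i
    irrefl : ∀ i → adj i i ≡ false
open Graph public

-- A set of edges is given by its (symmetric) indicator function.
EdgeSet : ℕ → Set
EdgeSet n = Fin n → Fin n → Bool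

IsEdgeSetOf : ∀ {n} → Graph n → EdgeSet n → Set
IsEdgeSetOf G H = (∀ i j → H i j ≡ H j i) × (∀ i j → H i j ≡ true → adj G i j ≡ true)

size : ∀ {n} → EdgeSet n → ℕ
size {n} H = sum (map (λ i → sum (map (λ j → if (toℕ i <ᵇ toℕ j) ∧ H i j then 1 else 0)
                                       (allFin n)))
                      (allFin n))

IsMatching : ∀ {n} → EdgeSet n → Set
IsMatching H = ∀ i j k → H i j ≡ true → H i k ≡ true → j ≡ k

Disjoint : ∀ {n} → EdgeSet n → EdgeSet n → Set
Disjoint H H' = ∀ i j → H i j ≡ true → H' i j ≡ true → ⊥

InB2 : ∀ {n} → Graph n → EdgeSet n → EdgeSet n → Set
InB2 G H H' = IsEdgeSetOf G H × IsEdgeSetOf G H' × IsMatching H × IsMatching H' × Disjoint H H'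

IsLambda : ∀ {n} → Graph n → ℕ → Set
IsLambda G l =
  Σ (EdgeSet _) (λ H → Σ (EdgeSet _) (λ H' → InB2 G H H' × size H + size H' ≡ l))
  × (∀ H H' → InB2 G H H' → size H + size H' ≤ l)

IsAlpha : ∀ {n} → Graph n → ℕ → ℕ → Set
IsAlpha G l a =
  Σ (EdgeSet _) (λ H → Σ (EdgeSet _) (λ H' →
       InB2 G H H' × size H + size H' ≡ l × size H ⊔ size H' ≡ a))
  × (∀ H H' → InB2 G H H' → size H + size H' ≡ l → size H ⊔ size H' ≤ a)

InM2 : ∀ {n} → Graph n → ℕ → ℕ → EdgeSet n → EdgeSet n → Set
InM2 G l a H H' = InB2 G H H' × size H + size H' ≡ l × size H ≡ a

-- The spanner: paths a₁b₁c₁d₁e₁, a₂b₂c₂d₂e₂ plus the edge c₁c₂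

data SV : Set where
  a₁ b₁ c₁ d₁ e₁ a₂ b₂ c₂ d₂ e₂ : SV

allSV : List SV
allSV = a₁ ∷ b₁ ∷ c₁ ∷ d₁ ∷ e₁ ∷ a₂ ∷ b₂ ∷ c₂ ∷ d₂ ∷ e₂ ∷ []

spEdge : SV → SV → Bool
spEdge a₁ b₁ = true
spEdge b₁ a₁ = true
spEdge b₁ c₁ = true
spEdge c₁ b₁ = true
spEdge c₁ d₁ = true
spEdge d₁ c₁ = true
spEdge d₁ e₁ = true
spEdge e₁ d₁ = true
spEdge a₂ b₂ = true
spEdge b₂ a₂ = true
spEdge b₂ c₂ = true
spEdge c₂ b₂ = true
spEdge c₂ d₂ = true
spEdge d₂ c₂ = true
spEdge d₂ e₂ = true
spEdge e₂ d₂ = true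
spEdge c₁ c₂ = true
spEdge c₂ c₁ = true
spEdge _  _  = false

spDeg : SV → ℕ
spDeg v = sum (map (λ t → if spEdge v t then 1 else 0) allSV)

-- base = nearest 3-vertex (the 3-vertices are c₁ and c₂)
base : SV → SV
base a₁ = c₁
base b₁ = c₁
base c₁ = c₁
base d₁ = c₁
base e₁ = c₁
base a₂ = c₂
base b₂ = c₂
base c₂ = c₂
base d₂ = c₂
base e₂ = c₂

-- Spanning S-forests: F is a spanning subgraph of G which is a disjoint
-- union of k spanners, given by a bijection V(G) ≅ Fin k × V(spanner);
-- the edges of F are exactly the images of spanner edges in each copy.

record SForest {n : ℕ} (G : Graph n) (k : ℕ) : Set where
  field
    iso : Fin n ↔ (Fin k × SV)
  comp : Fin n → Fin k
  comp x = proj₁ (Inverse.to iso x)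
  lab : Fin n → SV
  lab x = proj₂ (Inverse.to iso x)
  FEdge : Fin n → Fin n → Set
  FEdge x y = comp x ≡ comp y × spEdge (lab x) (lab y) ≡ true
  field
    spanning-sub : ∀ x y → FEdge x y → adj G x y ≡ true

module _ {n : ℕ} {G : Graph n} {k : ℕ} (F : SForest G k) where
  open SForest F

  IsVertexOfDeg : ℕ → Fin n → Set
  IsVertexOfDeg i x = spDeg (lab x) ≡ i

  UEdge : Fin n → Fin n → Set
  UEdge x y = FEdge x y × (IsVertexOfDeg 1 x ⊎ IsVertexOfDeg 1 y)

  LEdge : Fin n → Fin n → Set
  LEdge x y = FEdge x y × ¬ UEdge x y × (IsVertexOfDeg 2 x ⊎ IsVertexOfDeg 2 y)

  OneToBase : Fin n → Fin n → Set
  OneToBase x y = IsVertexOfDeg 1 x × comp x ≡ comp y × lab y ≡ base (lab x)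

  ΔEdge : Fin n → Fin n → Set
  ΔEdge x y = adj G x y ≡ true × (OneToBase x y ⊎ OneToBase y x)

  BEdge : Fin n → Fin n → Set
  BEdge x y = adj G x y ≡ true × ¬ LEdge x y × ¬ UEdge x y × ¬ ΔEdge x y

-- Start from any pair (S , S') ∈ M₂(G).  If one of the matchings, say
-- H, contains a Δ-edge uc (u a 1-vertex, c its base), let w be the neighbour
-- of u in F.  The hypothesis forces the only G-neighbours of w to be u and c,
-- so H misses w, and w lies on no Δ-edge.  Replacing uc by uw (or by cw, if
-- the other matching K already uses uw) keeps both matchings disjoint and of
-- the same sizes, so the pair stays in M₂(G), while the number of Δ-edges
-- drops by one.  Iterating, by induction on that number, ends in a Δ-free pair.

module Submission where

open import Defs hiding (sym)
open import Data.Nat using (ℕ; zero; suc; _+_; _<_; _<ᵇ_)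
open import Data.Nat.Properties
  using (+-suc; +-comm; <-cmp; <-asym; <ᵇ⇒<; <⇒<ᵇ; ≤-total; m≤n⇒m⊔n≡n; m≥n⇒m⊔n≡m; suc-injective)
  renaming (_≟_ to _≟ℕ_)
open import Data.Nat.ListAction using (sum)
open import Data.Bool using (Bool; true; false; if_then_else_; _∧_)
open import Data.Bool.Properties using (∧-zeroʳ) renaming (_≟_ to _≟B_)
open import Data.Fin using (Fin; toℕ; zero; suc)
open import Data.Fin.Patterns using (0F; 1F; 2F; 3F; 4F; 5F; 6F; 7F; 8F; 9F)
open import Data.Fin.Properties using (any?; all?; _≟_; toℕ-injective) renaming (suc-injective to fsuc-injective)
open import Data.List using (map; allFin; tabulate; lookup)
open import Data.List.Properties using (map-tabulate; tabulate-cong; map-cong)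
open import Data.Product using (Σ; _×_; _,_; proj₁; proj₂)
open import Data.Sum using (_⊎_; inj₁; inj₂; [_,_]; swap)
open import Data.Empty using (⊥-elim)
open import Function using (_∘_)
open import Function.Bundles using (Inverse)
open import Relation.Nullary using (¬_; Dec; yes; no; does)
open import Relation.Nullary.Decidable
  using (map′; _×-dec_; _⊎-dec_; _→-dec_; True; toWitness; dec-true; dec-false)
open import Relation.Binary.Definitions using (DecidableEquality; tri<; tri≈; tri>)
open import Relation.Binary.PropositionalEquality
  using (_≡_; _≢_; refl; sym; trans; cong; cong₂; subst; module ≡-Reasoning)

private variable
  n : ℕ

-- (1) Counting edges

ΣFin : (Fin n → ℕ) → ℕ
ΣFin {n} f = sum (map f (allFin n))

ΣFin-cong : (f g : Fin n → ℕ) → (∀ i → f i ≡ g i) → ΣFin f ≡ ΣFin g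
ΣFin-cong {n} f g f≗g = cong sum (map-cong f≗g (allFin n))

ΣFin-bump : (f g : Fin n → ℕ) (p : Fin n) → f p ≡ suc (g p)
          → (∀ i → i ≢ p → f i ≡ g i) → ΣFin f ≡ suc (ΣFin g)
ΣFin-bump {n} f g p fp rest = begin
  sum (map f (allFin n)) ≡⟨ cong sum (map-tabulate (λ i → i) f) ⟩
  sum (tabulate f)       ≡⟨ bump f g p fp rest ⟩
  suc (sum (tabulate g)) ≡⟨ cong (suc ∘ sum) (map-tabulate (λ i → i) g) ⟨
  suc (sum (map g (allFin n))) ∎
  where
  open ≡-Reasoning
  bump : ∀ {m} (f g : Fin m → ℕ) (p : Fin m) → f p ≡ suc (g p)
       → (∀ i → i ≢ p → f i ≡ g i) → sum (tabulate f) ≡ suc (sum (tabulate g))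
  bump f g zero fp rest =
    cong₂ _+_ fp (cong sum (tabulate-cong (λ i → rest (suc i) (λ ()))))
  bump f g (suc p) fp rest =
    trans (cong₂ _+_ (rest zero (λ ()))
                     (bump (f ∘ suc) (g ∘ suc) p fp (λ i i≢p → rest (suc i) (i≢p ∘ fsuc-injective))))
          (+-suc (g zero) _)

-- The summand of `size`: the ordered pair (i , j) counts when i < j, so that
-- size H is ΣFin (λ i → ΣFin (entry H i)) by definition.
entry : EdgeSet n → Fin n → Fin n → ℕ
entry H i j = if (toℕ i <ᵇ toℕ j) ∧ H i j then 1 else 0

SamePair : Fin n → Fin n → Fin n → Fin n → Set
SamePair p q i j = (i ≡ p × j ≡ q) ⊎ (i ≡ q × j ≡ p)

-- Kept opaque so that case analysis on it is not undone by unfolding.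
opaque
  samePair? : (p q i j : Fin n) → Dec (SamePair p q i j)
  samePair? p q i j = ((i ≟ p) ×-dec (j ≟ q)) ⊎-dec ((i ≟ q) ×-dec (j ≟ p))

samePair-flip : {p q i j : Fin n} → SamePair p q i j → SamePair p q j i
samePair-flip = [ (λ (a , b) → inj₂ (b , a)) , (λ (a , b) → inj₁ (b , a)) ]

SymmetricSet : EdgeSet n → Set
SymmetricSet H = ∀ i j → H i j ≡ H j i

at-pair : {H : EdgeSet n} {p q i j : Fin n} → SymmetricSet H → SamePair p q i j → H i j ≡ H p q
at-pair H-sym (inj₁ (refl , refl)) = refl
at-pair H-sym (inj₂ (refl , refl)) = H-sym _ _

size-drop-< : (H H' : EdgeSet n) (p q : Fin n) → toℕ p < toℕ q
            → H p q ≡ true → H' p q ≡ false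
            → (∀ i j → ¬ SamePair p q i j → H i j ≡ H' i j)
            → size H ≡ suc (size H')
size-drop-< H H' p q p<q Hpq H'pq agree =
  ΣFin-bump (row H) (row H') p
    (ΣFin-bump (entry H p) (entry H' p) q entry-pq (λ j j≢q → entry-agree p j (j≢q ∘ proj₂)))
    (λ i i≢p → ΣFin-cong _ _ (λ j → entry-agree i j (i≢p ∘ proj₁)))
  where
  row : EdgeSet _ → Fin _ → ℕ
  row K i = ΣFin (entry K i)

  entry-pq : entry H p q ≡ suc (entry H' p q)
  entry-pq with toℕ p <ᵇ toℕ q | <⇒<ᵇ p<q
  ... | true | _ rewrite Hpq | H'pq = refl

  -- (q , p) is never counted, so only (p , q) itself has to be excluded.
  entry-agree : ∀ i j → ¬ (i ≡ p × j ≡ q) → entry H i j ≡ entry H' i j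
  entry-agree i j not-pq with toℕ i <ᵇ toℕ j | <ᵇ⇒< (toℕ i) (toℕ j)
  ... | false | _ = refl
  ... | true | i<j rewrite agree i j [ not-pq , (λ { (refl , refl) → <-asym p<q (i<j _) }) ] = refl

size-drop : (H H' : EdgeSet n) (p q : Fin n) → SymmetricSet H → SymmetricSet H' → p ≢ q
          → H p q ≡ true → H' p q ≡ false
          → (∀ i j → ¬ SamePair p q i j → H i j ≡ H' i j)
          → size H ≡ suc (size H')
size-drop H H' p q H-sym H'-sym p≢q Hpq H'pq agree with <-cmp (toℕ p) (toℕ q)
... | tri< p<q _ _ = size-drop-< H H' p q p<q Hpq H'pq agree
... | tri≈ _ p≡q _ = ⊥-elim (p≢q (toℕ-injective p≡q))
... | tri> _ _ q<p = size-drop-< H H' q p q<p (trans (H-sym q p) Hpq) (trans (H'-sym q p) H'pq)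
                       (λ i j not-qp → agree i j (not-qp ∘ swap))

-- (2) Overriding one edge, and rotating an edge of a matching

override : Fin n → Fin n → Bool → EdgeSet n → EdgeSet n
override p q b H i j = if does (samePair? p q i j) then b else H i j

override-at : (p q : Fin n) (b : Bool) (H : EdgeSet n) → override p q b H p q ≡ b
override-at p q b H with samePair? p q p q
... | yes _ = refl
... | no not-pq = ⊥-elim (not-pq (inj₁ (refl , refl)))

override-outside : {p q i j : Fin n} (b : Bool) (H : EdgeSet n)
                 → ¬ SamePair p q i j → override p q b H i j ≡ H i j
override-outside {p = p} {q} {i} {j} b H not-pq with samePair? p q i j
... | yes pq = ⊥-elim (not-pq pq)
... | no _ = refl

override-sym : (p q : Fin n) (b : Bool) (H : EdgeSet n) → SymmetricSet H
             → SymmetricSet (override p q b H)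
override-sym p q b H H-sym i j with samePair? p q i j | samePair? p q j i
... | yes _ | yes _ = refl
... | no _ | no _ = H-sym i j
... | yes ij | no not-ji = ⊥-elim (not-ji (samePair-flip ij))
... | no not-ij | yes ji = ⊥-elim (not-ij (samePair-flip ji))

_∩_ : EdgeSet n → EdgeSet n → EdgeSet n
(H ∩ D) i j = H i j ∧ D i j

∩-sym : {H D : EdgeSet n} → SymmetricSet H → SymmetricSet D → SymmetricSet (H ∩ D)
∩-sym H-sym D-sym i j = cong₂ _∧_ (H-sym i j) (D-sym i j)

InB2-swap : (G : Graph n) {H K : EdgeSet n} → InB2 G H K → InB2 G K H
InB2-swap G (H-set , K-set , H-m , K-m , HK) = K-set , H-set , K-m , H-m , λ i j a b → HK i j b a

record Improvement (G : Graph n) (H K D : EdgeSet n) : Set where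
  field
    edges     : EdgeSet n
    valid     : InB2 G edges K
    same-size : size edges ≡ size H
    fewer     : size (H ∩ D) ≡ suc (size (edges ∩ D))

module Rotation (G : Graph n) (H K D : EdgeSet n) (HK-valid : InB2 G H K)
  (D-sym : SymmetricSet D) (p q r : Fin n) (p≢q : p ≢ q) (p≢r : p ≢ r) (q≢r : q ≢ r)
  (Hpq : H p q ≡ true) (r-free : ∀ z → H r z ≡ false) (adj-pr : adj G p r ≡ true) where

  H-set : IsEdgeSetOf G H
  H-set = proj₁ HK-valid

  H-sym : SymmetricSet H
  H-sym = proj₁ H-set

  K-set : IsEdgeSetOf G K
  K-set = proj₁ (proj₂ HK-valid)

  H-matching : IsMatching H
  H-matching = proj₁ (proj₂ (proj₂ HK-valid))

  K-matching : IsMatching K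
  K-matching = proj₁ (proj₂ (proj₂ (proj₂ HK-valid)))

  HK-disjoint : Disjoint H K
  HK-disjoint = proj₂ (proj₂ (proj₂ (proj₂ HK-valid)))

  H₀ : EdgeSet n
  H₀ = override p q false H

  R : EdgeSet n
  R = override p r true H₀

  not-pq-at-pr : ¬ SamePair p q p r
  not-pq-at-pr = [ q≢r ∘ sym ∘ proj₂ , p≢q ∘ proj₁ ]

  not-pr-at-pq : ¬ SamePair p r p q
  not-pr-at-pq = [ q≢r ∘ proj₂ , p≢r ∘ proj₁ ]

  Hpr : H p r ≡ false
  Hpr = trans (H-sym p r) (r-free p)

  R-sym : SymmetricSet R
  R-sym = override-sym p r true H₀ (override-sym p q false H H-sym)

  R-view : ∀ i j → R i j ≡ true → SamePair p r i j ⊎ (H i j ≡ true × ¬ SamePair p q i j)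
  R-view i j e with samePair? p r i j
  ... | yes pr = inj₁ pr
  ... | no _ with samePair? p q i j
  ...   | no not-pq = inj₂ (e , not-pq)

  R-adj : ∀ i j → R i j ≡ true → adj G i j ≡ true
  R-adj i j e with R-view i j e
  ... | inj₁ (inj₁ (refl , refl)) = adj-pr
  ... | inj₁ (inj₂ (refl , refl)) = trans (Graph.sym G r p) adj-pr
  ... | inj₂ (h , _) = proj₂ H-set i j h

  pr-partner : ∀ {i j k} → SamePair p r i j → SamePair p r i k → j ≡ k
  pr-partner (inj₁ (refl , refl)) (inj₁ (_ , refl)) = refl
  pr-partner (inj₁ (refl , refl)) (inj₂ (p≡r , _)) = ⊥-elim (p≢r p≡r)
  pr-partner (inj₂ (refl , refl)) (inj₁ (r≡p , _)) = ⊥-elim (p≢r (sym r≡p))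
  pr-partner (inj₂ (refl , refl)) (inj₂ (_ , refl)) = refl

  pr-vs-old : ∀ {i j k} → SamePair p r i j → H i k ≡ true → SamePair p q i k
  pr-vs-old (inj₁ (refl , refl)) Hpk = inj₁ (refl , H-matching p _ q Hpk Hpq)
  pr-vs-old (inj₂ (refl , refl)) Hrk with () ← trans (sym Hrk) (r-free _)

  R-matching : IsMatching R
  R-matching i j k Rij Rik with R-view i j Rij | R-view i k Rik
  ... | inj₁ ij | inj₁ ik = pr-partner ij ik
  ... | inj₁ ij | inj₂ (h , not-pq) = ⊥-elim (not-pq (pr-vs-old ij h))
  ... | inj₂ (h , not-pq) | inj₁ ik = ⊥-elim (not-pq (pr-vs-old ik h))
  ... | inj₂ (h , _) | inj₂ (h' , _) = H-matching i j k h h'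

  -- Both H and R arise from H₀ by adding one edge.
  R-size : size R ≡ size H
  R-size = begin
    size R         ≡⟨ size-drop R H₀ p r R-sym H₀-sym p≢r (override-at p r true H₀) H₀pr
                        (λ i j → override-outside true H₀) ⟩
    suc (size H₀)  ≡⟨ size-drop H H₀ p q H-sym H₀-sym p≢q Hpq (override-at p q false H)
                        (λ i j not-pq → sym (override-outside false H not-pq)) ⟨
    size H         ∎
    where
    open ≡-Reasoning
    H₀-sym : SymmetricSet H₀
    H₀-sym = override-sym p q false H H-sym
    H₀pr : H₀ p r ≡ false
    H₀pr = trans (override-outside false H not-pq-at-pr) Hpr

  R-disjoint : K p r ≡ false → Disjoint R K
  R-disjoint Kpr i j Rij Kij with R-view i j Rij
  ... | inj₁ pr with () ← trans (sym Kij) (trans (at-pair (proj₁ K-set) pr) Kpr)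
  ... | inj₂ (h , _) = HK-disjoint i j h Kij

  R-fewer : D p q ≡ true → D p r ≡ false → size (H ∩ D) ≡ suc (size (R ∩ D))
  R-fewer Dpq Dpr =
    size-drop (H ∩ D) (R ∩ D) p q (∩-sym H-sym D-sym) (∩-sym R-sym D-sym) p≢q
      (cong₂ _∧_ Hpq Dpq)
      (cong (_∧ D p q) (trans (override-outside true H₀ not-pr-at-pq) (override-at p q false H)))
      agree
    where
    agree : ∀ i j → ¬ SamePair p q i j → (H ∩ D) i j ≡ (R ∩ D) i j
    agree i j not-pq with samePair? p r i j
    ... | yes pr rewrite at-pair D-sym pr | Dpr = trans (∧-zeroʳ (H i j)) (sym (∧-zeroʳ true))
    ... | no _ = cong (_∧ D i j) (sym (override-outside false H not-pq))

  improvement : K p r ≡ false → D p q ≡ true → D p r ≡ false → Improvement G H K D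
  improvement Kpr Dpq Dpr = record
    { edges     = R
    ; valid     = (R-sym , R-adj) , K-set , R-matching , K-matching , R-disjoint Kpr
    ; same-size = R-size
    ; fewer     = R-fewer Dpq Dpr
    }

-- (3) Finite facts about the spanner

labelIndex : SV → Fin 10
labelIndex a₁ = 0F
labelIndex b₁ = 1F
labelIndex c₁ = 2F
labelIndex d₁ = 3F
labelIndex e₁ = 4F
labelIndex a₂ = 5F
labelIndex b₂ = 6F
labelIndex c₂ = 7F
labelIndex d₂ = 8F
labelIndex e₂ = 9F

label : Fin 10 → SV
label = lookup allSV

label-index : ∀ x → label (labelIndex x) ≡ x
label-index a₁ = refl
label-index b₁ = refl
label-index c₁ = refl
label-index d₁ = refl
label-index e₁ = refl
label-index a₂ = refl
label-index b₂ = refl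
label-index c₂ = refl
label-index d₂ = refl
label-index e₂ = refl

_≟SV_ : DecidableEquality SV
x ≟SV y = map′ (λ e → trans (sym (label-index x)) (trans (cong label e) (label-index y)))
               (cong labelIndex) (labelIndex x ≟ labelIndex y)

∀label? : {P : SV → Set} → (∀ x → Dec (P x)) → Dec (∀ x → P x)
∀label? {P} P? = map′ (λ all x → subst P (label-index x) (all (labelIndex x)))
                      (λ all i → all (label i)) (all? (P? ∘ label))

byEvaluation : {P : SV → Set} (P? : ∀ x → Dec (P x)) → {True (∀label? P?)} → ∀ x → P x
byEvaluation P? {ok} = toWitness ok

-- The unique neighbour of a 1-vertex (a leaf); irrelevant on other vertices.
nbr : SV → SV
nbr a₁ = b₁
nbr e₁ = d₁
nbr a₂ = b₂
nbr e₂ = d₂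
nbr ℓ  = ℓ

Leaf : SV → Set
Leaf ℓ = spDeg ℓ ≡ 1

leaf? : ∀ ℓ → Dec (Leaf ℓ)
leaf? ℓ = spDeg ℓ ≟ℕ 1

leaf-edge : ∀ ℓ → Leaf ℓ → spEdge ℓ (nbr ℓ) ≡ true
leaf-edge = byEvaluation (λ ℓ → leaf? ℓ →-dec (spEdge ℓ (nbr ℓ) ≟B true))

base-edge : ∀ ℓ → Leaf ℓ → spEdge (base ℓ) (nbr ℓ) ≡ true
base-edge = byEvaluation (λ ℓ → leaf? ℓ →-dec (spEdge (base ℓ) (nbr ℓ) ≟B true))

nbr-degree : ∀ ℓ → Leaf ℓ → spDeg (nbr ℓ) ≡ 2
nbr-degree = byEvaluation (λ ℓ → leaf? ℓ →-dec (spDeg (nbr ℓ) ≟ℕ 2))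

base-degree : ∀ ℓ → spDeg (base ℓ) ≡ 3
base-degree = byEvaluation (λ ℓ → spDeg (base ℓ) ≟ℕ 3)

nbr-neighbours : ∀ ℓ → Leaf ℓ → ∀ m → spEdge (nbr ℓ) m ≡ true → m ≡ ℓ ⊎ m ≡ base ℓ
nbr-neighbours = byEvaluation (λ ℓ → leaf? ℓ →-dec ∀label? (λ m →
  (spEdge (nbr ℓ) m ≟B true) →-dec ((m ≟SV ℓ) ⊎-dec (m ≟SV base ℓ))))

-- (4) The argument in an S-graph

ΔNeighbourCondition : {G : Graph n} {k : ℕ} → SForest G k → Set
ΔNeighbourCondition {n} F =
  ∀ u → IsVertexOfDeg F 1 u → Σ (Fin n) (λ y → ΔEdge F u y)
  → ∀ w → UEdge F u w → ∀ z → ¬ BEdge F w z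

ΔFree : {G : Graph n} {k : ℕ} → SForest G k → EdgeSet n → Set
ΔFree F S = ∀ x y → S x y ≡ true → ¬ ΔEdge F x y

module SGraph {G : Graph n} {k : ℕ} (F : SForest G k) where
  open SForest F

  vertex : Fin k → SV → Fin n
  vertex c ℓ = Inverse.from iso (c , ℓ)

  comp-vertex : ∀ c ℓ → comp (vertex c ℓ) ≡ c
  comp-vertex c ℓ = cong proj₁ (Inverse.strictlyInverseˡ iso (c , ℓ))

  lab-vertex : ∀ c ℓ → lab (vertex c ℓ) ≡ ℓ
  lab-vertex c ℓ = cong proj₂ (Inverse.strictlyInverseˡ iso (c , ℓ))

  vertex-unique : ∀ x y → comp x ≡ comp y → lab x ≡ lab y → x ≡ y
  vertex-unique x y ≡comp ≡lab = trans (sym (Inverse.strictlyInverseʳ iso x))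
    (trans (cong (Inverse.from iso) (cong₂ _,_ ≡comp ≡lab)) (Inverse.strictlyInverseʳ iso y))

  ≢-by-degree : ∀ {x y} → spDeg (lab x) ≢ spDeg (lab y) → x ≢ y
  ≢-by-degree ≢deg refl = ≢deg refl

  oneToBase? : ∀ x y → Dec (OneToBase F x y)
  oneToBase? x y = (spDeg (lab x) ≟ℕ 1) ×-dec ((comp x ≟ comp y) ×-dec (lab y ≟SV base (lab x)))

  -- Opaque for the same reason as samePair?.
  opaque
    Δ? : ∀ x y → Dec (ΔEdge F x y)
    Δ? x y = (adj G x y ≟B true) ×-dec (oneToBase? x y ⊎-dec oneToBase? y x)

  Δ-flip : ∀ {x y} → ΔEdge F x y → ΔEdge F y x
  Δ-flip {x} {y} (adj-xy , d) = trans (Graph.sym G y x) adj-xy , swap d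

  Δset : EdgeSet n
  Δset x y = does (Δ? x y)

  Δset-sym : SymmetricSet Δset
  Δset-sym x y with Δ? x y
  ... | yes d = sym (dec-true (Δ? y x) (Δ-flip d))
  ... | no ¬d = sym (dec-false (Δ? y x) (¬d ∘ Δ-flip))

  findΔ : (S : EdgeSet n) → Σ (Fin n) (λ x → Σ (Fin n) λ y → S x y ≡ true × ΔEdge F x y) ⊎ ΔFree F S
  findΔ S with any? (λ x → any? (λ y → (S x y ≟B true) ×-dec Δ? x y))
  ... | yes (x , y , e , d) = inj₁ (x , y , e , d)
  ... | no none = inj₂ (λ x y e d → none (x , y , e , d))

  -- The local picture at a Δ-edge uc (u a 1-vertex, c its base) under the
  -- hypothesis: w, the neighbour of u in F, is adjacent in G only to u and c.
  module AtΔEdge (cond : ΔNeighbourCondition F) (u c : Fin n) (adj-uc : adj G u c ≡ true)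
                 (u-to-c : OneToBase F u c) where
    ℓ : SV
    ℓ = lab u

    leaf : Leaf ℓ
    leaf = proj₁ u-to-c

    lab-c : lab c ≡ base ℓ
    lab-c = proj₂ (proj₂ u-to-c)

    w : Fin n
    w = vertex (comp u) (nbr ℓ)

    lab-w : lab w ≡ nbr ℓ
    lab-w = lab-vertex (comp u) (nbr ℓ)

    F-uw : FEdge u w
    F-uw = sym (comp-vertex _ _) , subst (λ t → spEdge ℓ t ≡ true) (sym lab-w) (leaf-edge ℓ leaf)

    F-cw : FEdge c w
    F-cw = trans (sym (proj₁ (proj₂ u-to-c))) (sym (comp-vertex _ _))
         , subst₂-spEdge (sym lab-c) (sym lab-w) (base-edge ℓ leaf)
      where
      subst₂-spEdge : ∀ {a a' b b'} → a ≡ a' → b ≡ b' → spEdge a b ≡ true → spEdge a' b' ≡ true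
      subst₂-spEdge refl refl e = e

    deg-c : spDeg (lab c) ≡ 3
    deg-c = trans (cong spDeg lab-c) (base-degree ℓ)

    deg-w : spDeg (lab w) ≡ 2
    deg-w = trans (cong spDeg lab-w) (nbr-degree ℓ leaf)

    u≢c : u ≢ c
    u≢c = ≢-by-degree (λ e → case-1≢3 (trans (sym leaf) (trans e deg-c)))
      where case-1≢3 : 1 ≢ 3
            case-1≢3 ()

    u≢w : u ≢ w
    u≢w = ≢-by-degree (λ e → case-1≢2 (trans (sym leaf) (trans e deg-w)))
      where case-1≢2 : 1 ≢ 2
            case-1≢2 ()

    c≢w : c ≢ w
    c≢w = ≢-by-degree (λ e → case-3≢2 (trans (sym deg-c) (trans e deg-w)))
      where case-3≢2 : 3 ≢ 2
            case-3≢2 ()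

    -- w is neither a 1-vertex nor a base, hence on no Δ-edge.
    w-not-Δ : ∀ z → ¬ ΔEdge F w z
    w-not-Δ z (_ , inj₁ (deg-w≡1 , _)) with () ← trans (sym deg-w) deg-w≡1
    w-not-Δ z (_ , inj₂ (_ , _ , w-base)) with () ← trans (sym deg-w) (trans (cong spDeg w-base) (base-degree (lab z)))

    F-neighbours-w : ∀ z → FEdge w z → z ≡ u ⊎ z ≡ c
    F-neighbours-w z (≡comp , wz) with nbr-neighbours ℓ leaf (lab z) (subst (λ t → spEdge t (lab z) ≡ true) lab-w wz)
    ... | inj₁ e = inj₁ (vertex-unique z u (trans (sym ≡comp) (comp-vertex _ _)) e)
    ... | inj₂ e = inj₂ (vertex-unique z c (trans (trans (sym ≡comp) (comp-vertex _ _)) (proj₁ (proj₂ u-to-c)))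
                                          (trans e (sym lab-c)))

    -- Any other G-edge at w would be a B-edge, which the hypothesis forbids.
    w-neighbours : ∀ z → adj G w z ≡ true → z ≡ u ⊎ z ≡ c
    w-neighbours z adj-wz with z ≟ u | z ≟ c
    ... | yes z≡u | _ = inj₁ z≡u
    ... | no _ | yes z≡c = inj₂ z≡c
    ... | no z≢u | no z≢c = ⊥-elim (no-B z (adj-wz , not-F ∘ proj₁ , not-F ∘ proj₁ , w-not-Δ z))
      where
      no-B : ∀ z → ¬ BEdge F w z
      no-B = cond u leaf (c , adj-uc , inj₁ u-to-c) w (F-uw , inj₁ leaf)
      not-F : ¬ FEdge w z
      not-F fe = [ z≢u , z≢c ] (F-neighbours-w z fe)

    module InMatching {H K : EdgeSet n} (HK-valid : InB2 G H K) (Huc : H u c ≡ true) where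
      H-sym : SymmetricSet H
      H-sym = proj₁ (proj₁ HK-valid)

      K-sym : SymmetricSet K
      K-sym = proj₁ (proj₁ (proj₂ HK-valid))

      H-matching : IsMatching H
      H-matching = proj₁ (proj₂ (proj₂ HK-valid))

      K-matching : IsMatching K
      K-matching = proj₁ (proj₂ (proj₂ (proj₂ HK-valid)))

      -- H uses uc, so it cannot use wu or wc, the only G-edges at w.
      w-free : ∀ z → H w z ≡ false
      w-free z with H w z in Hwz
      ... | false = refl
      ... | true with w-neighbours z (proj₂ (proj₁ HK-valid) w z Hwz)
      ...   | inj₁ refl = ⊥-elim (c≢w (sym (H-matching u w c (trans (H-sym u w) Hwz) Huc)))
      ...   | inj₂ refl = ⊥-elim (u≢w (sym (H-matching c w u (trans (H-sym c w) Hwz) (trans (H-sym c u) Huc))))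

      K-cw : K u w ≡ true → K c w ≡ false
      K-cw Kuw with K c w in Kcw
      ... | false = refl
      ... | true = ⊥-elim (u≢c (K-matching w u c (trans (K-sym w u) Kuw) (trans (K-sym w c) Kcw)))

      Δ-uc : Δset u c ≡ true
      Δ-uc = dec-true (Δ? u c) (adj-uc , inj₁ u-to-c)

      -- Rotate uc to uw, or to cw if K already uses uw.
      improve : Improvement G H K Δset
      improve with K u w in Kuw
      ... | false = Rotation.improvement G H K Δset HK-valid Δset-sym u c w u≢c u≢w c≢w Huc
                      w-free (spanning-sub u w F-uw) Kuw Δ-uc (dec-false (Δ? u w) (w-not-Δ u ∘ Δ-flip))
      ... | true = Rotation.improvement G H K Δset HK-valid Δset-sym c u w (u≢c ∘ sym) c≢w u≢w
                     (trans (H-sym c u) Huc) w-free (spanning-sub c w F-cw) (K-cw Kuw)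
                     (trans (Δset-sym c u) Δ-uc) (dec-false (Δ? c w) (w-not-Δ c ∘ Δ-flip))

  improve-Δ : ΔNeighbourCondition F → {H K : EdgeSet n} → InB2 G H K
            → ∀ x y → H x y ≡ true → ΔEdge F x y → Improvement G H K Δset
  improve-Δ cond HK-valid x y Hxy (adj-xy , inj₁ x-to-y) =
    AtΔEdge.InMatching.improve cond x y adj-xy x-to-y HK-valid Hxy
  improve-Δ cond HK-valid x y Hxy (adj-xy , inj₂ y-to-x) =
    AtΔEdge.InMatching.improve cond y x (trans (Graph.sym G y x) adj-xy) y-to-x HK-valid
      (trans (proj₁ (proj₁ HK-valid) y x) Hxy)

  ΔCount : EdgeSet n → EdgeSet n → ℕ
  ΔCount S S' = size (S ∩ Δset) + size (S' ∩ Δset)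

  data Progress (l a : ℕ) (S S' : EdgeSet n) : Set where
    done   : ΔFree F S → ΔFree F S' → Progress l a S S'
    better : (T T' : EdgeSet n) → InM2 G l a T T' → ΔCount S S' ≡ suc (ΔCount T T')
           → Progress l a S S'

  progress : ΔNeighbourCondition F → ∀ {l a S S'} → InM2 G l a S S' → Progress l a S S'
  progress cond {S = S} {S'} (valid , sum≡l , size≡a) with findΔ S
  ... | inj₁ (x , y , Sxy , Δxy) =
    better edges S' (valid′ , trans (cong (_+ size S') same-size) sum≡l , trans same-size size≡a)
           (cong (_+ size (S' ∩ Δset)) fewer)
    where open Improvement (improve-Δ cond valid x y Sxy Δxy) renaming (valid to valid′)
  ... | inj₂ S-free with findΔ S'
  ...   | inj₂ S'-free = done S-free S'-free
  ...   | inj₁ (x , y , S'xy , Δxy) =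
    better S edges (InB2-swap G valid′ , trans (cong (size S +_) same-size) sum≡l , size≡a)
           (trans (cong (size (S ∩ Δset) +_) fewer) (+-suc _ _))
    where open Improvement (improve-Δ cond (InB2-swap G valid) x y S'xy Δxy) renaming (valid to valid′)

  descend : ΔNeighbourCondition F → ∀ m {l a S S'} → InM2 G l a S S' → ΔCount S S' ≡ m
          → Σ (EdgeSet n) (λ T → Σ (EdgeSet n) (λ T' → InM2 G l a T T' × ΔFree F T × ΔFree F T'))
  descend cond m {S = S} {S'} inM2 count with progress cond inM2
  ... | done S-free S'-free = S , S' , inM2 , S-free , S'-free
  descend cond zero    _ count | better _ _ _     fewer with () ← trans (sym count) fewer
  descend cond (suc m) _ count | better _ _ inM2′ fewer =
    descend cond m inM2′ (suc-injective (trans (sym fewer) count))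

-- M₂(G) is non-empty: order a pair attaining α so that the larger matching comes first.
M2-witness : {G : Graph n} {l a : ℕ} → IsAlpha G l a
           → Σ (EdgeSet n) (λ S → Σ (EdgeSet n) (λ S' → InM2 G l a S S'))
M2-witness {G = G} ((H , H' , valid , sum≡l , max≡a) , _) with ≤-total (size H) (size H')
... | inj₁ H≤H' = H' , H , InB2-swap G valid , trans (+-comm (size H') (size H)) sum≡l
                , trans (sym (m≤n⇒m⊔n≡n H≤H')) max≡a
... | inj₂ H'≤H = H , H' , valid , sum≡l , trans (sym (m≥n⇒m⊔n≡m H'≤H)) max≡a

lemma27 : ∀ {n} (G : Graph n) (k : ℕ) (F : SForest G k)
          → (∀ u → IsVertexOfDeg F 1 u → Σ (Fin n) (λ y → ΔEdge F u y)
               → ∀ w → UEdge F u w → ∀ z → ¬ BEdge F w z)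
          → ∀ l a → IsLambda G l → IsAlpha G l a
          → Σ (EdgeSet n) (λ S → Σ (EdgeSet n) (λ S' →
               InM2 G l a S S'
               × (∀ x y → S x y ≡ true → ¬ ΔEdge F x y)
               × (∀ x y → S' x y ≡ true → ¬ ΔEdge F x y)))
lemma27 G k F cond l a _ α-attained with M2-witness {G = G} α-attained
... | S , S' , inM2 = SGraph.descend F cond _ inM2 refl
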